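{- Let $n\ge1$ and $w=(w_1,\dots,w_n)\in\mathbb{Z}_+^n$. Suppose $w=\sum_{k=i}^{N}\Pi(T_n,k)$ for some list $\Pi=(\pi_1,\dots,\pi_n)$ of cyclic permutations of $[2^n]$ and some $i\le N$ in $[2^n]$ (i.e. $w$ is a cyclic hyper degree). Then the number $N-i+1$ of binary sequences being summed belongs to $$\mathcal{N}_w=\{2w_\ell+t:\ \ell\in[n],\ t\in\{ -1,0,1\}\}.$$
   Context: $\mathbb{Z}_+$ denotes the nonnegative integers. For $m\ge0$ and $i\ge1$, $\mathrm{bin}(m,i)$ is the $i$-th bit of $m$ counted from the least significant bit. For $i\in[n]$, $c_{i,n}$ is the list of length $2^n$ with $c_{i,n}(j)=\mathrm{bin}(j-1,i)$. A cyclic permutation of order $k\ge0$ on $[m]$ is the map $i\mapsto 1+((i+k-1)\bmod m)$. For $k\in[2^n]$, $\Pi(T_n,k)=(c_{n,n}(\pi_n(k)),c_{n-1,n}(\pi_{n-1}(k)),\dots,c_{1,n}(\pi_1(k)))\in\{0,1\}^n$. A tuple $d\in\mathbb{Z}_+^n$ is a cyclic hyper degree if it is of the form $\sum_{k=i}^{N}\Pi(T_n,k)$ for such $\Pi$ and $i\le N$ in $[2^n]$. -}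

module Defs where

open import Data.Nat using (ℕ; zero; suc; _+_; _*_; _∸_; _^_)
open import Data.Nat.DivMod using (_/_; _%_)
open import Data.Fin using (Fin; toℕ; opposite)
open import Data.List using (upTo; map)
open import Data.Nat.ListAction using (sum)

-- bin m i : the i-th bit of m counted from the least significant bit (i ≥ 1).
-- bin m i = ⌊ m / 2^(i-1) ⌋ mod 2, computed by repeated halving.
bin : ℕ → ℕ → ℕ
bin m zero          = m % 2   -- i = 0 is outside the intended range; unused
bin m (suc zero)    = m % 2
bin m (suc (suc i)) = bin (m / 2) (suc i)

c : ℕ → ℕ → ℕ → ℕ
c i n j = bin (j ∸ 1) i

cyc : (m : ℕ) → ℕ → ℕ → ℕ
cyc zero    k i = i
cyc (suc m) k i = suc ((i + k ∸ 1) % suc m)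

-- A list Π = (π_1,…,π_n) of cyclic permutations of [2^n] is given by their
-- orders: ks j = order of π_{toℕ j + 1}.
-- Π(T_n,k) = (c_{n,n}(π_n(k)), …, c_{1,n}(π_1(k))) : its ℓ-th component
-- (ℓ = toℕ f + 1) is c_{n+1-ℓ,n}(π_{n+1-ℓ}(k)); note π_{n+1-ℓ} = ks (opposite f)
-- and n+1-ℓ = toℕ (opposite f) + 1.
PiT : (n : ℕ) → (Fin n → ℕ) → ℕ → Fin n → ℕ
PiT n ks k f = c (suc (toℕ (opposite f))) n (cyc (2 ^ n) (ks (opposite f)) k)

-- Σ_{k=i}^{N} g k  (empty if N < i)
sumFromTo : (ℕ → ℕ) → ℕ → ℕ → ℕ
sumFromTo g i N = sum (map (λ j → g (i + j)) (upTo (suc N ∸ i)))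

module Submission where

-- The last coordinate of Π(T_n,k) is c_{1,n}(π_1(k)), the
-- least significant bit of π_1(k) - 1.  Since π_1 is the cyclic shift of
-- order a on [2^n] and 2^n is even, reducing modulo 2^n does not change
-- parity, so this bit is the parity of k + a - 1.  Hence the last
-- coordinate w_n of the cyclic hyper degree counts the odd numbers in a
-- window of L = N - i + 1 consecutive naturals.  Any two consecutive
-- naturals contain exactly one odd number, so such a count s satisfies
-- 2s ∈ {L - 1, L, L + 1}, i.e. L = 2 w_n + t with t ∈ {-1, 0, 1}.

open import Defs
open import Data.Nat using (ℕ; zero; suc; _+_; _*_; _∸_; _^_; _≤_; _≥_; NonZero)
open import Data.Integer using (ℤ; +_; -[1+_]) renaming (_+_ to _+ℤ_)
open import Data.Fin as Fin using (Fin; fromℕ)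
open import Data.Product using (Σ; _×_; _,_)
open import Data.Sum using (_⊎_; inj₁; inj₂)
open import Relation.Binary.PropositionalEquality
  using (_≡_; refl; sym; trans; cong; cong₂; module ≡-Reasoning)
open import Data.Nat.Properties
  using (+-assoc; +-comm; +-suc; +-identityʳ; *-comm; *-distribˡ-+; +-∸-assoc; m^n≢0;
         +-commutativeSemigroup)
open import Algebra.Properties.CommutativeSemigroup +-commutativeSemigroup using (xy∙z≈xz∙y)
open import Data.Nat.DivMod using (_%_; [m+n]%n≡m%n; m∣n⇒o%n%m≡o%m)
open import Data.Nat.Divisibility using (_∣_; divides)
open import Data.Fin.Properties using (opposite-involutive)
open import Data.List using (applyUpTo)
open import Data.List.Properties using (map-upTo)
open import Data.Nat.ListAction using (sum)

-- Parity of a natural number, by recursion, so that it computes on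
-- successors.
parity : ℕ → ℕ
parity zero          = 0
parity (suc zero)    = 1
parity (suc (suc b)) = parity b

%2≡parity : ∀ b → b % 2 ≡ parity b
%2≡parity zero          = refl
%2≡parity (suc zero)    = refl
%2≡parity (suc (suc b)) = begin
  (2 + b) % 2 ≡⟨ cong (_% 2) (+-comm 2 b) ⟩
  (b + 2) % 2 ≡⟨ [m+n]%n≡m%n b 2 ⟩
  b % 2       ≡⟨ %2≡parity b ⟩
  parity b    ∎
  where open ≡-Reasoning

parity-consecutive : ∀ b → parity b + parity (suc b) ≡ 1
parity-consecutive zero          = refl
parity-consecutive (suc zero)    = refl
parity-consecutive (suc (suc b)) = parity-consecutive b

oddCount : ℕ → ℕ → ℕ
oddCount b zero    = 0
oddCount b (suc L) = parity b + oddCount (suc b) L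

oddCount-shift2 : ∀ b L → oddCount (suc (suc b)) L ≡ oddCount b L
oddCount-shift2 b zero    = refl
oddCount-shift2 b (suc L) = cong (λ x → parity b + x) (oddCount-shift2 (suc b) L)

oddCount-extend2 : ∀ b L → oddCount b (2 + L) ≡ suc (oddCount b L)
oddCount-extend2 b L = begin
  parity b + (parity (suc b) + oddCount (2 + b) L)
    ≡⟨ sym (+-assoc (parity b) (parity (suc b)) _) ⟩
  (parity b + parity (suc b)) + oddCount (2 + b) L
    ≡⟨ cong₂ _+_ (parity-consecutive b) (oddCount-shift2 b L) ⟩
  suc (oddCount b L) ∎
  where open ≡-Reasoning

NearHalf : ℕ → ℕ → Set
NearHalf L s = (2 * s ≡ L) ⊎ (2 * s + 1 ≡ L) ⊎ (2 * s ≡ suc L)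

double-suc : ∀ s → 2 * suc s ≡ 2 + 2 * s
double-suc s = *-distribˡ-+ 2 1 s

nearHalf-step : ∀ {L s} → NearHalf L s → NearHalf (2 + L) (suc s)
nearHalf-step {s = s} (inj₁ p)        = inj₁ (trans (double-suc s) (cong (λ x → 2 + x) p))
nearHalf-step {s = s} (inj₂ (inj₁ p)) = inj₂ (inj₁ (trans (cong (_+ 1) (double-suc s)) (cong (λ x → 2 + x) p)))
nearHalf-step {s = s} (inj₂ (inj₂ p)) = inj₂ (inj₂ (trans (double-suc s) (cong (λ x → 2 + x) p)))

oddCount-nearHalf : ∀ L b → NearHalf L (oddCount b L)
oddCount-nearHalf zero          b = inj₁ refl
oddCount-nearHalf (suc zero)    b with parity b | parity-consecutive b
... | zero          | _  = inj₂ (inj₁ refl)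
... | suc zero      | _  = inj₂ (inj₂ refl)
... | suc (suc _)   | ()
oddCount-nearHalf (suc (suc L)) b
  rewrite oddCount-extend2 b L = nearHalf-step (oddCount-nearHalf L b)

nearHalf⇒offset : ∀ {L s} → NearHalf L s
  → Σ ℤ (λ t → (t ≡ -[1+ 0 ] ⊎ t ≡ + 0 ⊎ t ≡ + 1) × (+ L ≡ (+ (2 * s)) +ℤ t))
nearHalf⇒offset {s = s} (inj₁ refl)        = + 0 , inj₂ (inj₁ refl) , cong +_ (sym (+-identityʳ (2 * s)))
nearHalf⇒offset         (inj₂ (inj₁ refl)) = + 1 , inj₂ (inj₂ refl) , refl
nearHalf⇒offset (inj₂ (inj₂ p)) rewrite p = -[1+ 0 ] , inj₁ refl , refl

sum-parities : ∀ L (f : ℕ → ℕ) b → (∀ j → f j ≡ parity (b + j))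
  → sum (applyUpTo f L) ≡ oddCount b L
sum-parities zero    f b hf = refl
sum-parities (suc L) f b hf = cong₂ _+_
  (trans (hf 0) (cong parity (+-identityʳ b)))
  (sum-parities L (λ j → f (suc j)) (suc b) (λ j → trans (hf (suc j)) (cong parity (+-suc b j))))

sumFromTo-parities : ∀ (g : ℕ → ℕ) i N b → (∀ j → g (i + j) ≡ parity (b + j))
  → sumFromTo g i N ≡ oddCount b (suc N ∸ i)
sumFromTo-parities g i N b hg =
  trans (cong sum (map-upTo (λ j → g (i + j)) (suc N ∸ i))) (sum-parities (suc N ∸ i) _ b hg)

-- Cyclic shifts modulo an even M preserve parity: the lowest bit of
-- π(k) - 1 is the parity of k + a - 1 for π the shift of order a.
cyc-lowBit : ∀ M a k → 2 ∣ M → .{{_ : NonZero M}} → bin (cyc M a k ∸ 1) 1 ≡ parity (k + a ∸ 1)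
cyc-lowBit (suc M') a k 2∣M =
  trans (m∣n⇒o%n%m≡o%m 2 (suc M') (k + a ∸ 1) 2∣M) (%2≡parity (k + a ∸ 1))

-- The last coordinate of Π(T_n,k) is c_{1,n}(π_1(k)), whose value is the
-- parity of k + a - 1 where a is the order of π_1 (the index ℓ = n is
-- mapped to π_1 because opposite (fromℕ m) = opposite (opposite 0) = 0).
PiT-last : ∀ m ks k → PiT (suc m) ks k (fromℕ m) ≡ parity (k + ks Fin.zero ∸ 1)
PiT-last m ks k
  rewrite opposite-involutive {suc m} Fin.zero
  = cyc-lowBit (2 ^ suc m) (ks Fin.zero) k (divides (2 ^ m) (*-comm 2 (2 ^ m))) {{m^n≢0 2 (suc m)}}

lemma16 : (n : ℕ) → n ≥ 1 → (w : Fin n → ℕ) → (ks : Fin n → ℕ) → (i N : ℕ)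
    → 1 ≤ i → i ≤ N → N ≤ 2 ^ n
    → ((ℓ : Fin n) → w ℓ ≡ sumFromTo (λ k → PiT n ks k ℓ) i N)
    → Σ (Fin n) (λ ℓ → Σ ℤ (λ t → (t ≡ -[1+ 0 ] ⊎ t ≡ + 0 ⊎ t ≡ + 1)
    × (+ (N ∸ i + 1) ≡ (+ (2 * w ℓ)) +ℤ t)))
lemma16 (suc m) _ w ks (suc i') N _ i≤N _ hw = fromℕ m , offset
  where
    -- w_n counts the odd numbers in the window [b, b + N - i], b = i + a - 1
    b : ℕ
    b = i' + ks Fin.zero

    lastBit : ∀ j → PiT (suc m) ks (suc i' + j) (fromℕ m) ≡ parity (b + j)
    lastBit j = trans (PiT-last m ks (suc i' + j)) (cong parity (xy∙z≈xz∙y i' j (ks Fin.zero)))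

    w-last : w (fromℕ m) ≡ oddCount b (N ∸ i')
    w-last = trans (hw (fromℕ m)) (sumFromTo-parities (λ k → PiT (suc m) ks k (fromℕ m)) (suc i') N b lastBit)

    length : N ∸ suc i' + 1 ≡ N ∸ i'
    length = trans (+-comm (N ∸ suc i') 1) (sym (+-∸-assoc 1 i≤N))

    offset : Σ ℤ (λ t → (t ≡ -[1+ 0 ] ⊎ t ≡ + 0 ⊎ t ≡ + 1)
               × (+ (N ∸ suc i' + 1) ≡ (+ (2 * w (fromℕ m))) +ℤ t))
    offset rewrite length | w-last = nearHalf⇒offset {s = oddCount b (N ∸ i')} (oddCount-nearHalf (N ∸ i') b)
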